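{- Let $C$ be a cubic ring. Among the cubic subrings of $C$ (subrings containing $1$ that are free of rank $3$ as $\mathbb{Z}$-modules) that are $\mathbb{Z}$-mat, there is a unique maximal one, which contains all the others.
   Context: A cubic ring is a commutative ring with unit isomorphic to $\mathbb{Z}^3$ as a $\mathbb{Z}$-module. A cubic ring is called $\mathbb{Z}$-mat if the trace of every one of its elements is divisible by $3$. -}

module Defs where

open import Data.Fin using (Fin; zero; suc)
open import Data.Integer using (ℤ; +_; _+_; _*_)
open import Data.Integer.Divisibility using (_∣_)
open import Data.Product using (Σ; _×_)
open import Relation.Binary.PropositionalEquality using (_≡_)

-- The underlying ℤ-module ℤ³ of a cubic ring (after choosing a ℤ-basis).
V : Set
V = Fin 3 → ℤ

i₀ i₁ i₂ : Fin 3
i₀ = zero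
i₁ = suc zero
i₂ = suc (suc zero)

Σ3 : (Fin 3 → ℤ) → ℤ
Σ3 f = f i₀ + (f i₁ + f i₂)

_≋_ : V → V → Set
x ≋ y = ∀ k → x k ≡ y k

0V : V
0V _ = + 0

lin : (Fin 3 → V) → (Fin 3 → ℤ) → V
lin B a k = Σ3 (λ i → a i * B i k)

-- A cubic ring: a commutative unital ring structure on ℤ³, given by
-- structure constants  e_i e_j = Σ_k c i j k e_k  (so multiplication is
-- automatically ℤ-bilinear, hence distributive), with commutativity,
-- associativity and a unit element.
record CubicRing : Set where
  field
    c     : Fin 3 → Fin 3 → Fin 3 → ℤ
    one   : V
  mul : V → V → V
  mul x y k = Σ3 (λ i → Σ3 (λ j → (x i * y j) * c i j k))
  field
    comm  : ∀ i j k → c i j k ≡ c j i k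
    assoc : ∀ x y z → mul (mul x y) z ≋ mul x (mul y z)
    unit  : ∀ x → mul one x ≋ x

InSpan : (Fin 3 → V) → V → Set
InSpan B x = Σ (Fin 3 → ℤ) (λ a → x ≋ lin B a)

Independent : (Fin 3 → V) → Set
Independent B = ∀ a → lin B a ≋ 0V → ∀ i → a i ≡ + 0

IsCubicSubring : CubicRing → (Fin 3 → V) → Set
IsCubicSubring C B =
  Independent B × InSpan B (CubicRing.one C) ×
  (∀ x y → InSpan B x → InSpan B y → InSpan B (CubicRing.mul C x y))

-- The cubic subring spanned by B is ℤ-mat: for every element x of it, the
-- trace of multiplication by x on the subring (computed as the trace of the
-- matrix m of  y ↦ x y  in the basis B) is divisible by 3.
IsZMatSub : CubicRing → (Fin 3 → V) → Set
IsZMatSub C B =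
  ∀ x → InSpan B x → ∀ (m : Fin 3 → Fin 3 → ℤ) →
  (∀ i → CubicRing.mul C x (B i) ≋ lin B (m i)) →
  (+ 3) ∣ Σ3 (λ i → m i i)

{-# OPTIONS --safe #-}
module Submission where

-- The maximal ℤ-mat subring is {x ∈ C : x³ ∈ ℤ·1 + 3C}.  If x lies in a ℤ-mat
-- subring B and m is the matrix of multiplication by x on B, then 3 ∣ tr m and
-- 3 ∣ tr m², hence 3 ∣ e₂ m by Newton's identity 2e₂ = tr² − tr m², and
-- Cayley–Hamilton applied to 1 ∈ B gives x³ ≡ det m · 1 modulo 3B.  Conversely,
-- if x³ = n·1 + 3u then the trace of x³ on C is 3n + 3 tr u, and
-- tr x³ ≡ (tr x)³ mod 3 forces 3 ∣ tr x; the trace on a full-rank subring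
-- agrees with the trace on C.  The set of such x is closed under the ring
-- operations (the cross terms of (x + y)³ come in threes) and contains 3C, so it
-- is a lattice between 3ℤ³ and ℤ³, with an upper triangular basis whose
-- diagonal entries are 1 or 3, found by a search among vectors with entries in
-- {0, 1, 2}.

open import Defs
open import Algebra.Bundles.Raw using (RawRing)
open import Data.Empty using (⊥-elim)
open import Data.Fin using (Fin; zero; suc; toℕ; fromℕ<)
open import Data.Fin.Properties using (any?; all?; toℕ-injective; toℕ<n; toℕ-fromℕ<)
open import Data.Integer using (ℤ; +_; _+_; _*_; -_; _-_; -1ℤ; ∣_∣; NonZero; +-*-rawRing)
open import Data.Integer.DivMod using (_%ℕ_; _/ℕ_; n%ℕd<d; a≡a%ℕn+[a/ℕn]*n)
import Data.Integer.Divisibility as Unsigned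
open import Data.Integer.Divisibility.Signed
  using (_∣_; divides; _∣?_; ∣⇒∣ᵤ; ∣ᵤ⇒∣; ∣m+n∣n⇒∣m; ∣m⇒∣m*n; ∣-refl)
open import Data.Integer.Properties
  using (_≟_; *-comm; *-identityʳ; *-zeroʳ; +-identityˡ; *-cancelˡ-≡; i*j≢0; abs-*)
open import Data.Integer.Tactic.RingSolver using (ring; solve-∀)
open import Data.Nat using (ℕ; _<_; s≤s; z≤n)
import Data.Nat as ℕ
import Data.Nat.Divisibility as ℕ
open import Data.Nat.Primality using (Prime; prime?; euclidsLemma)
open import Data.Nat.Properties using (_<?_; m<1+n⇒m<n∨m≡n)
open import Data.Product using (Σ; ∃; _×_; _,_; proj₁; proj₂)
open import Data.Sum using (inj₁; inj₂; reduce)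
open import Data.Vec.N-ary using (N-ary)
open import Function using (_∘_)
open import Level using (0ℓ)
open import Relation.Nullary using (Dec; yes; no; ¬_; ¬?; _×-dec_; _→-dec_)
open import Relation.Nullary.Decidable using (map′; from-yes)
open import Relation.Binary.PropositionalEquality
open import Tactic.RingSolver.Core.Expression using (Expr; Κ)
  renaming (_⊕_ to _:+_; _⊗_ to _:*_; ⊝_ to :-_)
open import Tactic.RingSolver.NonReflective ring using (solve; _⊜_)
open ≡-Reasoning

vec3 : {A : Set} → A → A → A → Fin 3 → A
vec3 a b c zero = a
vec3 a b c (suc zero) = b
vec3 a b c (suc (suc zero)) = c

matrix : {A : Set} → A → A → A → A → A → A → A → A → A → Fin 3 → Fin 3 → A
matrix a₀ a₁ a₂ a₃ a₄ a₅ a₆ a₇ a₈ = vec3 (vec3 a₀ a₁ a₂) (vec3 a₃ a₄ a₅) (vec3 a₆ a₇ a₈)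

infixl 6 _⊕_
infixr 7 _⊙_

_⊕_ : V → V → V
(x ⊕ y) k = x k + y k

_⊙_ : ℤ → V → V
(a ⊙ x) k = a * x k

≋-refl : ∀ {x} → x ≋ x
≋-refl _ = refl

≋-sym : ∀ {x y} → x ≋ y → y ≋ x
≋-sym h k = sym (h k)

Σ3-cong : ∀ {f g : Fin 3 → ℤ} → (∀ i → f i ≡ g i) → Σ3 f ≡ Σ3 g
Σ3-cong h = cong₂ _+_ (h i₀) (cong₂ _+_ (h i₁) (h i₂))

Σ3-+ : ∀ (f g : Fin 3 → ℤ) → Σ3 (λ i → f i + g i) ≡ Σ3 f + Σ3 g
Σ3-+ f g = shuffle (f i₀) (f i₁) (f i₂) (g i₀) (g i₁) (g i₂)
  where shuffle : ∀ a b c d e f → (a + d) + ((b + e) + (c + f)) ≡ (a + (b + c)) + (d + (e + f))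
        shuffle = solve-∀

Σ3-*ˡ : ∀ n (f : Fin 3 → ℤ) → Σ3 (λ i → n * f i) ≡ n * Σ3 f
Σ3-*ˡ n f = factor n (f i₀) (f i₁) (f i₂)
  where factor : ∀ n a b c → n * a + (n * b + n * c) ≡ n * (a + (b + c))
        factor = solve-∀

lin-cong : ∀ B {a b} → a ≋ b → lin B a ≋ lin B b
lin-cong B h k = Σ3-cong (λ i → cong (_* B i k) (h i))

-- Matrices are lists of rows, so  lin B a  is the row vector a times B.  The
-- operations are defined over any raw ring: over ℤ, and over the syntax of
-- ring expressions, where the non-reflective ring solver can decide identities
-- between them.
module Matrices (R : RawRing 0ℓ 0ℓ) where
  open RawRing R using (Carrier; 0#; 1#) renaming (_+_ to _⊞_; _*_ to _⊠_; -_ to ⊟_)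

  infixl 6 _⊖_
  _⊖_ : Carrier → Carrier → Carrier
  x ⊖ y = x ⊞ ⊟ y

  Σ₃ : (Fin 3 → Carrier) → Carrier
  Σ₃ f = f i₀ ⊞ (f i₁ ⊞ f i₂)

  combination : (Fin 3 → Fin 3 → Carrier) → (Fin 3 → Carrier) → Fin 3 → Carrier
  combination B a k = Σ₃ (λ i → a i ⊠ B i k)

  infixl 7 _·_
  _·_ : (Fin 3 → Fin 3 → Carrier) → (Fin 3 → Fin 3 → Carrier) → Fin 3 → Fin 3 → Carrier
  (n · m) i = combination m (n i)

  tr : (Fin 3 → Fin 3 → Carrier) → Carrier
  tr m = Σ₃ (λ i → m i i)

  e₂ : (Fin 3 → Fin 3 → Carrier) → Carrier
  e₂ m = (m i₀ i₀ ⊠ m i₁ i₁ ⊖ m i₀ i₁ ⊠ m i₁ i₀)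
       ⊞ (m i₀ i₀ ⊠ m i₂ i₂ ⊖ m i₀ i₂ ⊠ m i₂ i₀)
       ⊞ (m i₁ i₁ ⊠ m i₂ i₂ ⊖ m i₁ i₂ ⊠ m i₂ i₁)

  det : (Fin 3 → Fin 3 → Carrier) → Carrier
  det m = m i₀ i₀ ⊠ (m i₁ i₁ ⊠ m i₂ i₂ ⊖ m i₁ i₂ ⊠ m i₂ i₁)
        ⊖ m i₀ i₁ ⊠ (m i₁ i₀ ⊠ m i₂ i₂ ⊖ m i₁ i₂ ⊠ m i₂ i₀)
        ⊞ m i₀ i₂ ⊠ (m i₁ i₀ ⊠ m i₂ i₁ ⊖ m i₁ i₁ ⊠ m i₂ i₀)

  adj : (Fin 3 → Fin 3 → Carrier) → Fin 3 → Fin 3 → Carrier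
  adj m = matrix (m i₁ i₁ ⊠ m i₂ i₂ ⊖ m i₁ i₂ ⊠ m i₂ i₁)
                 (m i₀ i₂ ⊠ m i₂ i₁ ⊖ m i₀ i₁ ⊠ m i₂ i₂)
                 (m i₀ i₁ ⊠ m i₁ i₂ ⊖ m i₀ i₂ ⊠ m i₁ i₁)
                 (m i₁ i₂ ⊠ m i₂ i₀ ⊖ m i₁ i₀ ⊠ m i₂ i₂)
                 (m i₀ i₀ ⊠ m i₂ i₂ ⊖ m i₀ i₂ ⊠ m i₂ i₀)
                 (m i₀ i₂ ⊠ m i₁ i₀ ⊖ m i₀ i₀ ⊠ m i₁ i₂)
                 (m i₁ i₀ ⊠ m i₂ i₁ ⊖ m i₁ i₁ ⊠ m i₂ i₀)
                 (m i₀ i₁ ⊠ m i₂ i₀ ⊖ m i₀ i₀ ⊠ m i₂ i₁)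
                 (m i₀ i₀ ⊠ m i₁ i₁ ⊖ m i₀ i₁ ⊠ m i₁ i₀)

  δ : Fin 3 → Fin 3 → Carrier
  δ = matrix 1# 0# 0# 0# 1# 0# 0# 0# 1#

Mat : Set
Mat = Fin 3 → V

open Matrices +-*-rawRing using (_·_; tr; e₂; det; adj; δ)

expressions : ℕ → RawRing 0ℓ 0ℓ
expressions n = record
  { Carrier = Expr ℤ n ; _≈_ = _≡_ ; _+_ = _:+_ ; _*_ = _:*_ ; -_ = :-_ ; 0# = Κ (+ 0) ; 1# = Κ (+ 1) }

module P {n} = Matrices (expressions n)

δ-diag : ∀ k → δ k k ≡ + 1
δ-diag zero = refl
δ-diag (suc zero) = refl
δ-diag (suc (suc zero)) = refl

-- A ring identity about vectors or matrices is proved for ones whose entries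
-- are variables and then instantiated at the entries of arbitrary ones.  The
-- instance is definitionally the identity itself, provided every index in it is
-- a constructor; this is why identities about a single coordinate k are proved
-- one value of k at a time.

∀V : (V → Set) → Set
∀V P = ∀ a₀ a₁ a₂ → P (vec3 a₀ a₁ a₂)

∀M : (Mat → Set) → Set
∀M P = ∀V λ r₀ → ∀V λ r₁ → ∀V λ r₂ → P (vec3 r₀ r₁ r₂)

∀VM : (V → Mat → Set) → Set
∀VM P = ∀V λ a → ∀M (P a)

∀MM : (Mat → Mat → Set) → Set
∀MM P = ∀M λ p → ∀M (P p)

entries : V → V
entries a = vec3 (a i₀) (a i₁) (a i₂)

entriesM : Mat → Mat
entriesM m = vec3 (entries (m i₀)) (entries (m i₁)) (entries (m i₂))

entrywiseV : (P : V → Set) → ∀V P → ∀ a → P (entries a)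
entrywiseV P h a = h (a i₀) (a i₁) (a i₂)

entrywiseM : (P : Mat → Set) → ∀M P → ∀ m → P (entriesM m)
entrywiseM P h m =
  entrywiseV (λ r → P (vec3 (entries (m i₀)) (entries (m i₁)) r))
    (entrywiseV (λ r₁ → ∀V λ r₂ → P (vec3 (entries (m i₀)) r₁ r₂))
      (entrywiseV (λ r₀ → ∀V λ r₁ → ∀V λ r₂ → P (vec3 r₀ r₁ r₂)) h (m i₀)) (m i₁)) (m i₂)

entrywiseVM : (P : V → Mat → Set) → ∀VM P → ∀ a m → P (entries a) (entriesM m)
entrywiseVM P h a = entrywiseM (P (entries a)) (entrywiseV (λ a → ∀M (P a)) h a)

entrywiseMM : (P : Mat → Mat → Set) → ∀MM P → ∀ p m → P (entriesM p) (entriesM m)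
entrywiseMM P h p = entrywiseM (P (entriesM p)) (entrywiseM (λ p → ∀M (P p)) h p)

onV : ∀ {n} {B : Set} → ((Fin 3 → Expr ℤ n) → B) → N-ary 3 (Expr ℤ n) B
onV f a₀ a₁ a₂ = f (vec3 a₀ a₁ a₂)

onM : ∀ {n} {B : Set} → ((Fin 3 → Fin 3 → Expr ℤ n) → B) → N-ary 9 (Expr ℤ n) B
onM f a₀ a₁ a₂ a₃ a₄ a₅ a₆ a₇ a₈ = f (matrix a₀ a₁ a₂ a₃ a₄ a₅ a₆ a₇ a₈)

onVM : ∀ {n} {B : Set} → ((Fin 3 → Expr ℤ n) → (Fin 3 → Fin 3 → Expr ℤ n) → B) → N-ary 12 (Expr ℤ n) B
onVM f a₀ a₁ a₂ = onM (f (vec3 a₀ a₁ a₂))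

onMM : ∀ {n} {B : Set} → ((Fin 3 → Fin 3 → Expr ℤ n) → (Fin 3 → Fin 3 → Expr ℤ n) → B) → N-ary 18 (Expr ℤ n) B
onMM f a₀ a₁ a₂ a₃ a₄ a₅ a₆ a₇ a₈ = onM (f (matrix a₀ a₁ a₂ a₃ a₄ a₅ a₆ a₇ a₈))

Σ3-swap : ∀ (f : Mat) → Σ3 (λ i → Σ3 (λ j → f i j)) ≡ Σ3 (λ j → Σ3 (λ i → f i j))
Σ3-swap = entrywiseM (λ f → Σ3 (λ i → Σ3 (λ j → f i j)) ≡ Σ3 (λ j → Σ3 (λ i → f i j)))
  (solve 9 (onM λ f → P.Σ₃ (λ i → P.Σ₃ (λ j → f i j)) ⊜ P.Σ₃ (λ j → P.Σ₃ (λ i → f i j))) refl)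

LinAssoc : V → Mat → V → Set
LinAssoc a n v = Σ3 (λ j → lin n a j * v j) ≡ Σ3 (λ i → a i * Σ3 (λ j → n i j * v j))

lin-· : ∀ a n m k → lin m (lin n a) k ≡ lin (n · m) a k
lin-· a n m k = entrywiseV (LinAssoc (entries a) (entriesM n))
  (entrywiseVM (λ a n → ∀V (LinAssoc a n)) assoc a n) (λ j → m j k)
  where
    assoc : ∀VM λ a n → ∀V (LinAssoc a n)
    assoc = solve 15 (onVM λ a n → onV λ v →
      P.Σ₃ (λ j → P.combination n a j :* v j) ⊜ P.Σ₃ (λ i → a i :* P.Σ₃ (λ j → n i j :* v j))) refl

LinLinear : ℤ → ℤ → V → V → V → Set
LinLinear p q a b v = Σ3 (λ j → (p * a j + q * b j) * v j) ≡ p * Σ3 (λ j → a j * v j) + q * Σ3 (λ j → b j * v j)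

lin-linear : ∀ p q a b (B : Mat) k → lin B (λ j → p * a j + q * b j) k ≡ p * lin B a k + q * lin B b k
lin-linear p q a b B k = entrywiseV (LinLinear p q (entries a) (entries b))
  (entrywiseV (λ b → ∀V (LinLinear p q (entries a) b))
    (entrywiseV (λ a → ∀V λ b → ∀V (LinLinear p q a b)) (linear p q) a) b) (λ j → B j k)
  where
    linear : ∀ p q → ∀V λ a → ∀V λ b → ∀V (LinLinear p q a b)
    linear = solve 11 (λ p q → onV λ a → onV λ b → onV λ v →
      P.Σ₃ (λ j → (p :* a j :+ q :* b j) :* v j)
        ⊜ (p :* P.Σ₃ (λ j → a j :* v j) :+ q :* P.Σ₃ (λ j → b j :* v j))) refl

IdentityAt : Fin 3 → V → Set
IdentityAt k v = lin δ v k ≡ v k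

lin-δ : ∀ v → lin δ v ≋ v
lin-δ v zero = entrywiseV (IdentityAt i₀) (solve 3 (onV λ v → P.combination P.δ v i₀ ⊜ v i₀) refl) v
lin-δ v (suc zero) = entrywiseV (IdentityAt i₁) (solve 3 (onV λ v → P.combination P.δ v i₁ ⊜ v i₁) refl) v
lin-δ v (suc (suc zero)) = entrywiseV (IdentityAt i₂) (solve 3 (onV λ v → P.combination P.δ v i₂ ⊜ v i₂) refl) v

RowAt : Fin 3 → V → Set
RowAt i v = Σ3 (λ j → δ i j * v j) ≡ v i

lin-at-δ : ∀ B i → lin B (δ i) ≋ B i
lin-at-δ B zero k = entrywiseV (RowAt i₀) (solve 3 (onV λ v → P.Σ₃ (λ j → P.δ i₀ j :* v j) ⊜ v i₀) refl) (λ j → B j k)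
lin-at-δ B (suc zero) k = entrywiseV (RowAt i₁) (solve 3 (onV λ v → P.Σ₃ (λ j → P.δ i₁ j :* v j) ⊜ v i₁) refl) (λ j → B j k)
lin-at-δ B (suc (suc zero)) k = entrywiseV (RowAt i₂) (solve 3 (onV λ v → P.Σ₃ (λ j → P.δ i₂ j :* v j) ⊜ v i₂) refl) (λ j → B j k)

Newton₂ Newton₃ : Mat → Set
Newton₂ m = + 2 * e₂ m ≡ tr m * tr m - tr (m · m)
Newton₃ m = tr (m · m · m) ≡ tr m * (tr m * tr m) + + 3 * (det m - tr m * e₂ m)

newton₂ : ∀ m → Newton₂ m
newton₂ = entrywiseM Newton₂ (solve 9 (onM λ m →
  Κ (+ 2) :* P.e₂ m ⊜ (P.tr m :* P.tr m P.⊖ P.tr (m P.· m))) refl)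

newton₃ : ∀ m → Newton₃ m
newton₃ = entrywiseM Newton₃ (solve 9 (onM λ m →
  P.tr (m P.· m P.· m) ⊜ (P.tr m :* (P.tr m :* P.tr m) :+ Κ (+ 3) :* (P.det m P.⊖ P.tr m :* P.e₂ m))) refl)

CayleyHamilton : Fin 3 → V → Mat → Set
CayleyHamilton k a m = lin (m · m · m) a k ≡ tr m * lin (m · m) a k - e₂ m * lin m a k + det m * a k

cayley-hamilton-expr : ∀ {n} → Fin 3 → (Fin 3 → Expr ℤ n) → (Fin 3 → Fin 3 → Expr ℤ n) → Expr ℤ n × Expr ℤ n
cayley-hamilton-expr k a m = P.combination (m P.· m P.· m) a k
  ⊜ (P.tr m :* P.combination (m P.· m) a k P.⊖ P.e₂ m :* P.combination m a k :+ P.det m :* a k)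

cayley-hamilton : ∀ a m k → CayleyHamilton k a m
cayley-hamilton a m zero = entrywiseVM (CayleyHamilton i₀) (solve 12 (onVM (cayley-hamilton-expr i₀)) refl) a m
cayley-hamilton a m (suc zero) = entrywiseVM (CayleyHamilton i₁) (solve 12 (onVM (cayley-hamilton-expr i₁)) refl) a m
cayley-hamilton a m (suc (suc zero)) = entrywiseVM (CayleyHamilton i₂) (solve 12 (onVM (cayley-hamilton-expr i₂)) refl) a m

AdjugateAt : Fin 3 → V → Mat → Set
AdjugateAt k a p = lin (adj p) (lin p a) k ≡ det p * a k

adjugate-expr : ∀ {n} → Fin 3 → (Fin 3 → Expr ℤ n) → (Fin 3 → Fin 3 → Expr ℤ n) → Expr ℤ n × Expr ℤ n
adjugate-expr k a p = P.combination (P.adj p) (P.combination p a) k ⊜ P.det p :* a k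

adjugate : ∀ a p k → AdjugateAt k a p
adjugate a p zero = entrywiseVM (AdjugateAt i₀) (solve 12 (onVM (adjugate-expr i₀)) refl) a p
adjugate a p (suc zero) = entrywiseVM (AdjugateAt i₁) (solve 12 (onVM (adjugate-expr i₁)) refl) a p
adjugate a p (suc (suc zero)) = entrywiseVM (AdjugateAt i₂) (solve 12 (onVM (adjugate-expr i₂)) refl) a p

TraceAdjugateʳ TraceConjugate : Mat → Mat → Set
TraceAdjugateʳ p m = tr (m · p · adj p) ≡ det p * tr m
TraceConjugate p x = tr (p · x · adj p) ≡ det p * tr x

trace-adjugateʳ : ∀ p m → TraceAdjugateʳ p m
trace-adjugateʳ = entrywiseMM TraceAdjugateʳ (solve 18 (onMM λ p m →
  P.tr (m P.· p P.· P.adj p) ⊜ P.det p :* P.tr m) refl)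

trace-conjugate : ∀ p x → TraceConjugate p x
trace-conjugate = entrywiseMM TraceConjugate (solve 18 (onMM λ p x →
  P.tr (p P.· x P.· P.adj p) ⊜ P.det p :* P.tr x) refl)

trace-similar : ∀ p x m → .{{NonZero (det p)}} → (∀ i → lin x (p i) ≋ lin p (m i)) → tr m ≡ tr x
trace-similar p x m px≡mp = *-cancelˡ-≡ (det p) (tr m) (tr x) (begin
  det p * tr m        ≡⟨ sym (trace-adjugateʳ p m) ⟩
  tr (m · p · adj p)  ≡⟨ Σ3-cong (λ i → sym (lin-cong (adj p) (px≡mp i) i)) ⟩
  tr (p · x · adj p)  ≡⟨ trace-conjugate p x ⟩
  det p * tr x        ∎)

det≢0⇒independent : ∀ p → .{{NonZero (det p)}} → Independent p
det≢0⇒independent p a ap≡0 k = *-cancelˡ-≡ (det p) (a k) (+ 0) (begin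
  det p * a k              ≡⟨ sym (adjugate a p k) ⟩
  lin (adj p) (lin p a) k  ≡⟨ lin-cong (adj p) ap≡0 k ⟩
  + 0                      ≡⟨ sym (*-zeroʳ (det p)) ⟩
  det p * + 0              ∎)

det-upper-triangular : ∀ p → p i₁ i₀ ≡ + 0 → p i₂ i₀ ≡ + 0 → p i₂ i₁ ≡ + 0 →
                       det p ≡ p i₀ i₀ * (p i₁ i₁ * p i₂ i₂)
det-upper-triangular p =
  upper (p i₀ i₀) (p i₀ i₁) (p i₀ i₂) (p i₁ i₀) (p i₁ i₁) (p i₁ i₂) (p i₂ i₀) (p i₂ i₁) (p i₂ i₂)
  where
    triangular : ∀ a b c e f i → det (matrix a b c (+ 0) e f (+ 0) (+ 0) i) ≡ a * (e * i)
    triangular = solve 6 (λ a b c e f i →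
      P.det (matrix a b c (Κ (+ 0)) e f (Κ (+ 0)) (Κ (+ 0)) i) ⊜ a :* (e :* i)) refl
    upper : ∀ a b c d e f g h i → d ≡ + 0 → g ≡ + 0 → h ≡ + 0 → det (matrix a b c d e f g h i) ≡ a * (e * i)
    upper a b c _ e f _ _ i refl refl refl = triangular a b c e f i

residue : ℤ → Fin 3
residue z = fromℕ< (n%ℕd<d z 3)

residue-spec : ∀ z → z ≡ + toℕ (residue z) + + 3 * (z /ℕ 3)
residue-spec z = begin
  z                                   ≡⟨ a≡a%ℕn+[a/ℕn]*n z 3 ⟩
  + (z %ℕ 3) + (z /ℕ 3) * + 3          ≡⟨ cong₂ _+_ (cong +_ (sym (toℕ-fromℕ< _))) (*-comm (z /ℕ 3) (+ 3)) ⟩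
  + toℕ (residue z) + + 3 * (z /ℕ 3)   ∎

prime-3 : Prime 3
prime-3 = from-yes (prime? 3)

3∣cube⇒3∣ : ∀ t → + 3 Unsigned.∣ t * (t * t) → + 3 Unsigned.∣ t
3∣cube⇒3∣ t 3∣t³ with euclidsLemma ∣ t ∣ ∣ t * t ∣ prime-3 (subst (3 ℕ.∣_) (abs-* t (t * t)) 3∣t³)
... | inj₁ 3∣t = 3∣t
... | inj₂ 3∣t² = reduce (euclidsLemma ∣ t ∣ ∣ t ∣ prime-3 (subst (3 ℕ.∣_) (abs-* t t) 3∣t²))

-- With t = 3a and s = 3b, 2e = 9a² − 3b gives e = 3(e − 3a² + b).
3∣e₂ : ∀ {e t s} → + 2 * e ≡ t * t - s → + 3 ∣ t → + 3 ∣ s → + 3 ∣ e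
3∣e₂ {e} newton (divides a refl) (divides b refl) = divides (e - + 3 * (a * a) + b) (sym (begin
  (e - + 3 * (a * a) + b) * + 3                            ≡⟨ expand e a b ⟩
  e + (+ 2 * e - ((a * + 3) * (a * + 3) - b * + 3))        ≡⟨ cong (λ z → e + (z - ((a * + 3) * (a * + 3) - b * + 3))) newton ⟩
  e + (((a * + 3) * (a * + 3) - b * + 3) - ((a * + 3) * (a * + 3) - b * + 3)) ≡⟨ cancel e a b ⟩
  e                                                         ∎))
  where
    expand : ∀ e a b → (e - + 3 * (a * a) + b) * + 3 ≡ e + (+ 2 * e - ((a * + 3) * (a * + 3) - b * + 3))
    expand = solve-∀
    cancel : ∀ e a b → e + (((a * + 3) * (a * + 3) - b * + 3) - ((a * + 3) * (a * + 3) - b * + 3)) ≡ e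
    cancel = solve-∀

cayley-hamilton-mod3 : ∀ m → + 3 ∣ tr m → + 3 ∣ tr (m · m) → ∀ a →
  Σ V λ s → ∀ j → lin (m · m · m) a j ≡ det m * a j + + 3 * s j
cayley-hamilton-mod3 m 3∣tr@(divides t tr≡) 3∣tr² a = (λ j → t * lin (m · m) a j - w * lin m a j) , λ j → begin
  lin (m · m · m) a j
    ≡⟨ cayley-hamilton a m j ⟩
  tr m * lin (m · m) a j - e₂ m * lin m a j + det m * a j
    ≡⟨ cong₂ (λ T E → T * lin (m · m) a j - E * lin m a j + det m * a j) tr≡ e₂≡ ⟩
  t * + 3 * lin (m · m) a j - w * + 3 * lin m a j + det m * a j
    ≡⟨ regroup t w (lin (m · m) a j) (lin m a j) (det m * a j) ⟩
  det m * a j + + 3 * (t * lin (m · m) a j - w * lin m a j) ∎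
  where
    3∣e₂m : + 3 ∣ e₂ m
    3∣e₂m = 3∣e₂ {e₂ m} {tr m} {tr (m · m)} (newton₂ m) 3∣tr 3∣tr²
    w = _∣_.quotient 3∣e₂m
    e₂≡ = _∣_.equality 3∣e₂m
    regroup : ∀ t w p q d → t * + 3 * p - w * + 3 * q + d ≡ d + + 3 * (t * p - w * q)
    regroup = solve-∀

VanishesBefore : ℕ → V → Set
VanishesBefore n x = ∀ j → toℕ j < n → x j ≡ + 0

vanishes? : ∀ n x → Dec (VanishesBefore n x)
vanishes? n x = all? (λ j → (toℕ j <? n) →-dec (x j ≟ + 0))

δ-vanishes : ∀ k → VanishesBefore (toℕ k) (δ k)
δ-vanishes (suc zero) zero _ = refl
δ-vanishes (suc (suc zero)) zero _ = refl
δ-vanishes (suc (suc zero)) (suc zero) _ = refl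
δ-vanishes (suc zero) (suc j) (s≤s ())
δ-vanishes (suc (suc zero)) (suc (suc j)) (s≤s (s≤s ()))

module TriangularBasis
  (L : V → Set)
  (L-resp : ∀ {x y} → x ≋ y → L x → L y)
  (L-⊕ : ∀ {x y} → L x → L y → L (x ⊕ y))
  (L-⊙ : ∀ n {x} → L x → L (n ⊙ x))
  (L-3 : ∀ w → L (+ 3 ⊙ w))
  (L? : ∀ x → Dec (L x))
  where

  record Pivot (k : Fin 3) : Set where
    field
      vector        : V
      height        : ℤ
      height≢0      : NonZero height
      member        : L vector
      vanishes      : VanishesBefore (toℕ k) vector
      at-pivot      : vector k ≡ height
      divides-pivot : ∀ x → L x → VanishesBefore (toℕ k) x → height ∣ x k

  residues : (Fin 3 → Fin 3) → V
  residues ρ j = + toℕ (ρ j)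

  reduced : V → V
  reduced x = residues (vec3 (residue (x i₀)) (residue (x i₁)) (residue (x i₂)))

  reduced-entry : ∀ x j → reduced x j ≡ + toℕ (residue (x j))
  reduced-entry x zero = refl
  reduced-entry x (suc zero) = refl
  reduced-entry x (suc (suc zero)) = refl

  reduced-member : ∀ {x} → L x → L (reduced x)
  reduced-member {x} x∈L = L-resp shift (L-⊕ x∈L (L-3 (λ j → - (x j /ℕ 3))))
    where
      cancel : ∀ r q → (r + + 3 * q) + + 3 * - q ≡ r
      cancel = solve-∀
      shift : (x ⊕ + 3 ⊙ (λ j → - (x j /ℕ 3))) ≋ reduced x
      shift j = trans (cong (_+ + 3 * - (x j /ℕ 3)) (residue-spec (x j)))
                      (trans (cancel _ (x j /ℕ 3)) (sym (reduced-entry x j)))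

  -- Since 3ℤ³ ⊆ L, some vector of L vanishing before k has a k-th entry prime
  -- to 3 iff some reduced one does, and there are only finitely many of those.
  Candidate : Fin 3 → V → Set
  Candidate k v = L v × VanishesBefore (toℕ k) v × ¬ v k ≡ + 0

  HasCandidate : Fin 3 → Set
  HasCandidate k = ∃ λ r₀ → ∃ λ r₁ → ∃ λ r₂ → Candidate k (residues (vec3 r₀ r₁ r₂))

  hasCandidate? : ∀ k → Dec (HasCandidate k)
  hasCandidate? k = any? λ r₀ → any? λ r₁ → any? λ r₂ → candidate? (residues (vec3 r₀ r₁ r₂))
    where candidate? : ∀ v → Dec (Candidate k v)
          candidate? v = L? v ×-dec vanishes? (toℕ k) v ×-dec ¬? (v k ≟ + 0)

  unit-pivot : ∀ k ρ → Candidate k (residues ρ) → Pivot k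
  unit-pivot k ρ (v∈L , v-vanishes , vk≢0) with ρ k in ρk
  ... | zero = ⊥-elim (vk≢0 refl)
  ... | suc zero = record
    { vector = residues ρ ; height = + 1 ; height≢0 = _ ; member = v∈L
    ; vanishes = v-vanishes ; at-pivot = cong (+_ ∘ toℕ) ρk
    ; divides-pivot = λ x _ _ → divides (x k) (sym (*-identityʳ (x k))) }
  ... | suc (suc zero) = record
    { vector = + 3 ⊙ δ k ⊕ -1ℤ ⊙ residues ρ ; height = + 1 ; height≢0 = _
    ; member = L-⊕ (L-3 (δ k)) (L-⊙ -1ℤ v∈L)
    ; vanishes = λ j j<k → cong₂ combine (δ-vanishes k j j<k) (v-vanishes j j<k)
    ; at-pivot = cong₂ combine (δ-diag k) (cong (+_ ∘ toℕ) ρk)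
    ; divides-pivot = λ x _ _ → divides (x k) (sym (*-identityʳ (x k))) }
    where
      combine : ℤ → ℤ → ℤ
      combine a b = + 3 * a + -1ℤ * b

  no-candidate⇒3∣ : ∀ k → ¬ HasCandidate k → ∀ x → L x → VanishesBefore (toℕ k) x → + 3 ∣ x k
  no-candidate⇒3∣ k none x x∈L x-vanishes with residue (x k) in rk
  ... | zero = divides (x k /ℕ 3) (begin
    x k                                      ≡⟨ residue-spec (x k) ⟩
    + toℕ (residue (x k)) + + 3 * (x k /ℕ 3) ≡⟨ cong (λ r → + toℕ r + + 3 * (x k /ℕ 3)) rk ⟩
    + 0 + + 3 * (x k /ℕ 3)                   ≡⟨ flip (x k /ℕ 3) ⟩
    x k /ℕ 3 * + 3                           ∎)
    where
      flip : ∀ q → + 0 + + 3 * q ≡ q * + 3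
      flip = solve-∀
  ... | suc r = ⊥-elim (none (residue (x i₀) , residue (x i₁) , residue (x i₂) ,
                               reduced-member x∈L , reduced-vanishes , reduced-k≢0))
    where
      reduced-vanishes : VanishesBefore (toℕ k) (reduced x)
      reduced-vanishes j j<k = trans (reduced-entry x j) (cong (+_ ∘ toℕ ∘ residue) (x-vanishes j j<k))
      reduced-k≢0 : ¬ reduced x k ≡ + 0
      reduced-k≢0 e with trans (sym (cong (+_ ∘ toℕ) rk)) (trans (sym (reduced-entry x k)) e)
      ... | ()

  triple-pivot : ∀ k → ¬ HasCandidate k → Pivot k
  triple-pivot k none = record
    { vector = + 3 ⊙ δ k ; height = + 3 ; height≢0 = _ ; member = L-3 (δ k)
    ; vanishes = λ j j<k → cong (+ 3 *_) (δ-vanishes k j j<k)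
    ; at-pivot = cong (+ 3 *_) (δ-diag k)
    ; divides-pivot = no-candidate⇒3∣ k none }

  pivot-from : ∀ k → Dec (HasCandidate k) → Pivot k
  pivot-from k (yes (r₀ , r₁ , r₂ , candidate)) = unit-pivot k (vec3 r₀ r₁ r₂) candidate
  pivot-from k (no none) = triple-pivot k none

  pivot : ∀ k → Pivot k
  pivot k = pivot-from k (hasCandidate? k)

  peel : ∀ {k} (p : Pivot k) x → L x → VanishesBefore (toℕ k) x →
         Σ ℤ λ q → L (x ⊕ - q ⊙ Pivot.vector p) × VanishesBefore (ℕ.suc (toℕ k)) (x ⊕ - q ⊙ Pivot.vector p)
  peel {k} p x x∈L x-vanishes = q , L-⊕ x∈L (L-⊙ (- q) member) , vanishes′
    where
      open Pivot p
      q = _∣_.quotient (divides-pivot x x∈L x-vanishes)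
      cancel₀ : ∀ q → + 0 + - q * + 0 ≡ + 0
      cancel₀ = solve-∀
      cancel : ∀ q h → q * h + - q * h ≡ + 0
      cancel = solve-∀
      vanishes′ : VanishesBefore (ℕ.suc (toℕ k)) (x ⊕ - q ⊙ vector)
      vanishes′ j j≤k with m<1+n⇒m<n∨m≡n j≤k
      ... | inj₁ j<k = trans (cong₂ (λ a b → a + - q * b) (x-vanishes j j<k) (vanishes j j<k)) (cancel₀ q)
      ... | inj₂ j≡k with toℕ-injective j≡k
      ... | refl = trans (cong₂ (λ a b → a + - q * b) (_∣_.equality (divides-pivot x x∈L x-vanishes)) at-pivot)
                         (cancel q height)

  basis : Mat
  basis k = Pivot.vector (pivot k)

  basis-det≢0 : NonZero (det basis)
  basis-det≢0 = subst NonZero (sym det≡) (i*j≢0 h₀ (h₁ * h₂)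
                  {{height≢0 (pivot i₀)}} {{i*j≢0 h₁ h₂ {{height≢0 (pivot i₁)}} {{height≢0 (pivot i₂)}}}})
    where
      open Pivot using (height; height≢0; at-pivot; vanishes)
      h₀ = height (pivot i₀)
      h₁ = height (pivot i₁)
      h₂ = height (pivot i₂)
      det≡ : det basis ≡ h₀ * (h₁ * h₂)
      det≡ = trans (det-upper-triangular basis (vanishes (pivot i₁) i₀ (s≤s z≤n))
                      (vanishes (pivot i₂) i₀ (s≤s z≤n)) (vanishes (pivot i₂) i₁ (s≤s (s≤s z≤n))))
                   (cong₂ _*_ (at-pivot (pivot i₀)) (cong₂ _*_ (at-pivot (pivot i₁)) (at-pivot (pivot i₂))))

  basis-spans : ∀ x → L x → InSpan basis x
  basis-spans x x∈L = vec3 q₀ q₁ q₂ , λ k → unpeel (x k) q₀ q₁ q₂ _ _ _ (x₃-vanishes k (toℕ<n k))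
    where
      step₀ = peel (pivot i₀) x x∈L (λ _ ())
      q₀ = proj₁ step₀
      x₁ = x ⊕ - q₀ ⊙ basis i₀
      step₁ = peel (pivot i₁) x₁ (proj₁ (proj₂ step₀)) (proj₂ (proj₂ step₀))
      q₁ = proj₁ step₁
      x₂ = x₁ ⊕ - q₁ ⊙ basis i₁
      step₂ = peel (pivot i₂) x₂ (proj₁ (proj₂ step₁)) (proj₂ (proj₂ step₁))
      q₂ = proj₁ step₂
      x₃-vanishes : VanishesBefore 3 (x₂ ⊕ - q₂ ⊙ basis i₂)
      x₃-vanishes = proj₂ (proj₂ step₂)
      unpeel : ∀ z q₀ q₁ q₂ u v w → z + - q₀ * u + - q₁ * v + - q₂ * w ≡ + 0 → z ≡ q₀ * u + (q₁ * v + q₂ * w)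
      unpeel z q₀ q₁ q₂ u v w rest≡0 = begin
        z                                                                     ≡⟨ split z q₀ q₁ q₂ u v w ⟩
        (z + - q₀ * u + - q₁ * v + - q₂ * w) + (q₀ * u + (q₁ * v + q₂ * w))   ≡⟨ cong (_+ (q₀ * u + (q₁ * v + q₂ * w))) rest≡0 ⟩
        + 0 + (q₀ * u + (q₁ * v + q₂ * w))                                    ≡⟨ +-identityˡ _ ⟩
        q₀ * u + (q₁ * v + q₂ * w)                                            ∎
        where split : ∀ z q₀ q₁ q₂ u v w → z ≡ (z + - q₀ * u + - q₁ * v + - q₂ * w) + (q₀ * u + (q₁ * v + q₂ * w))
              split = solve-∀

  span-member : ∀ x → InSpan basis x → L x
  span-member x (a , x≋) = L-resp (λ k → sym (x≋ k))
    (L-⊕ (L-⊙ (a i₀) (member i₀)) (L-⊕ (L-⊙ (a i₁) (member i₁)) (L-⊙ (a i₂) (member i₂))))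
    where member : ∀ k → L (basis k)
          member k = Pivot.member (pivot k)

module CubicRingProperties (C : CubicRing) where
  open CubicRing C

  mul-cong : ∀ {x x′ y y′} → x ≋ x′ → y ≋ y′ → mul x y ≋ mul x′ y′
  mul-cong hx hy k = Σ3-cong (λ i → Σ3-cong (λ j → cong (_* c i j k) (cong₂ _*_ (hx i) (hy j))))

  mul-congʳ : ∀ x {y y′} → y ≋ y′ → mul x y ≋ mul x y′
  mul-congʳ x = mul-cong {x} ≋-refl

  mul-congˡ : ∀ y {x x′} → x ≋ x′ → mul x y ≋ mul x′ y
  mul-congˡ y h = mul-cong h (≋-refl {y})

  mul-comm : ∀ x y → mul x y ≋ mul y x
  mul-comm x y k = begin
    mul x y k
      ≡⟨ Σ3-cong (λ i → Σ3-cong (λ j → cong₂ _*_ (*-comm (x i) (y j)) (comm i j k))) ⟩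
    Σ3 (λ i → Σ3 (λ j → (y j * x i) * c j i k))
      ≡⟨ Σ3-swap (λ i j → (y j * x i) * c j i k) ⟩
    mul y x k ∎

  mul-⊕ʳ : ∀ x y z → mul x (y ⊕ z) ≋ (mul x y ⊕ mul x z)
  mul-⊕ʳ x y z k = begin
    mul x (y ⊕ z) k
      ≡⟨ Σ3-cong (λ i → Σ3-cong (λ j → distrib (x i) (y j) (z j) (c i j k))) ⟩
    Σ3 (λ i → Σ3 (λ j → (x i * y j) * c i j k + (x i * z j) * c i j k))
      ≡⟨ Σ3-cong (λ i → Σ3-+ (λ j → (x i * y j) * c i j k) (λ j → (x i * z j) * c i j k)) ⟩
    Σ3 (λ i → Σ3 (λ j → (x i * y j) * c i j k) + Σ3 (λ j → (x i * z j) * c i j k))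
      ≡⟨ Σ3-+ (λ i → Σ3 (λ j → (x i * y j) * c i j k)) (λ i → Σ3 (λ j → (x i * z j) * c i j k)) ⟩
    mul x y k + mul x z k ∎
    where distrib : ∀ x y z c → (x * (y + z)) * c ≡ (x * y) * c + (x * z) * c
          distrib = solve-∀

  mul-⊙ʳ : ∀ x a y → mul x (a ⊙ y) ≋ (a ⊙ mul x y)
  mul-⊙ʳ x a y k = begin
    mul x (a ⊙ y) k
      ≡⟨ Σ3-cong (λ i → Σ3-cong (λ j → pull (x i) a (y j) (c i j k))) ⟩
    Σ3 (λ i → Σ3 (λ j → a * ((x i * y j) * c i j k)))
      ≡⟨ Σ3-cong (λ i → Σ3-*ˡ a (λ j → (x i * y j) * c i j k)) ⟩
    Σ3 (λ i → a * Σ3 (λ j → (x i * y j) * c i j k))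
      ≡⟨ Σ3-*ˡ a (λ i → Σ3 (λ j → (x i * y j) * c i j k)) ⟩
    a * mul x y k ∎
    where pull : ∀ x a y c → (x * (a * y)) * c ≡ a * ((x * y) * c)
          pull = solve-∀

  mul-⊕ˡ : ∀ x y z → mul (x ⊕ y) z ≋ (mul x z ⊕ mul y z)
  mul-⊕ˡ x y z k = trans (mul-comm (x ⊕ y) z k)
    (trans (mul-⊕ʳ z x y k) (cong₂ _+_ (mul-comm z x k) (mul-comm z y k)))

  mul-⊙ˡ : ∀ a x y → mul (a ⊙ x) y ≋ (a ⊙ mul x y)
  mul-⊙ˡ a x y k = trans (mul-comm (a ⊙ x) y k)
    (trans (mul-⊙ʳ y a x k) (cong (a *_) (mul-comm y x k)))

  mul-identityʳ : ∀ x → mul x one ≋ x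
  mul-identityʳ x k = trans (mul-comm x one k) (unit x k)

  mul-linʳ : ∀ x B a → mul x (lin B a) ≋ lin (λ i → mul x (B i)) a
  mul-linʳ x B a k = begin
    mul x (lin B a) k
      ≡⟨ Σ3-cong (λ p → Σ3-cong (λ q → expand (x p) (c p q k) (a i₀) (a i₁) (a i₂) (B i₀ q) (B i₁ q) (B i₂ q))) ⟩
    Σ3 (λ p → Σ3 (λ q → Σ3 (λ i → a i * ((x p * B i q) * c p q k))))
      ≡⟨ Σ3-cong (λ p → Σ3-swap (λ q i → a i * ((x p * B i q) * c p q k))) ⟩
    Σ3 (λ p → Σ3 (λ i → Σ3 (λ q → a i * ((x p * B i q) * c p q k))))
      ≡⟨ Σ3-swap (λ p i → Σ3 (λ q → a i * ((x p * B i q) * c p q k))) ⟩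
    Σ3 (λ i → Σ3 (λ p → Σ3 (λ q → a i * ((x p * B i q) * c p q k))))
      ≡⟨ Σ3-cong (λ i → trans (Σ3-cong (λ p → Σ3-*ˡ (a i) (λ q → (x p * B i q) * c p q k)))
                               (Σ3-*ˡ (a i) (λ p → Σ3 (λ q → (x p * B i q) * c p q k)))) ⟩
    lin (λ i → mul x (B i)) a k ∎
    where expand : ∀ x c a₀ a₁ a₂ b₀ b₁ b₂ →
                   (x * (a₀ * b₀ + (a₁ * b₁ + a₂ * b₂))) * c ≡
                   a₀ * ((x * b₀) * c) + (a₁ * ((x * b₁) * c) + a₂ * ((x * b₂) * c))
          expand = solve-∀

  Represents : Mat → V → Mat → Set
  Represents B x m = ∀ i → mul x (B i) ≋ lin B (m i)

  represents-lin : ∀ {B x m} → Represents B x m → ∀ a → mul x (lin B a) ≋ lin B (lin m a)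
  represents-lin {B} {x} {m} hm a k = begin
    mul x (lin B a) k             ≡⟨ mul-linʳ x B a k ⟩
    lin (λ i → mul x (B i)) a k   ≡⟨ Σ3-cong (λ i → cong (a i *_) (hm i k)) ⟩
    lin (m · B) a k               ≡⟨ sym (lin-· a m B k) ⟩
    lin B (lin m a) k             ∎

  represents-mul : ∀ {B x y m n} → Represents B x m → Represents B y n → Represents B (mul x y) (n · m)
  represents-mul {B} {x} {y} {m} {n} hx hy i k = begin
    mul (mul x y) (B i) k   ≡⟨ assoc x y (B i) k ⟩
    mul x (mul y (B i)) k   ≡⟨ mul-congʳ x (hy i) k ⟩
    mul x (lin B (n i)) k   ≡⟨ represents-lin {B} {x} {m} hx (n i) k ⟩
    lin B (lin m (n i)) k   ∎

  cube : V → V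
  cube x = mul x (mul x x)

  represents-cube : ∀ {B x m} → Represents B x m → Represents B (cube x) (m · m · m)
  represents-cube {B} {x} {m} hx = represents-mul {B} {x} {mul x x} {m} {m · m} hx (represents-mul {B} {x} {x} {m} {m} hx hx)

  cube-cong : ∀ {x y} → x ≋ y → cube x ≋ cube y
  cube-cong h = mul-cong h (mul-cong h h)

  mul-interchange : ∀ a b c d → mul (mul a b) (mul c d) ≋ mul (mul a c) (mul b d)
  mul-interchange a b c′ d k = begin
    mul (mul a b) (mul c′ d) k ≡⟨ assoc a b (mul c′ d) k ⟩
    mul a (mul b (mul c′ d)) k ≡⟨ mul-congʳ a (≋-sym (assoc b c′ d)) k ⟩
    mul a (mul (mul b c′) d) k ≡⟨ mul-congʳ a (mul-congˡ d (mul-comm b c′)) k ⟩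
    mul a (mul (mul c′ b) d) k ≡⟨ mul-congʳ a (assoc c′ b d) k ⟩
    mul a (mul c′ (mul b d)) k ≡⟨ sym (assoc a c′ (mul b d) k) ⟩
    mul (mul a c′) (mul b d) k ∎

  cube-mul : ∀ x y → cube (mul x y) ≋ mul (cube x) (cube y)
  cube-mul x y k = trans (mul-congʳ (mul x y) (mul-interchange x y x y) k) (mul-interchange x y (mul x x) (mul y y) k)

  mul-rotate : ∀ x y → mul y (mul x y) ≋ mul x (mul y y)
  mul-rotate x y k = begin
    mul y (mul x y) k ≡⟨ mul-congʳ y (mul-comm x y) k ⟩
    mul y (mul y x) k ≡⟨ sym (assoc y y x k) ⟩
    mul (mul y y) x k ≡⟨ mul-comm (mul y y) x k ⟩
    mul x (mul y y) k ∎

  cube-⊕ : ∀ x y → cube (x ⊕ y) ≋ (cube x ⊕ cube y ⊕ + 3 ⊙ (mul x (mul x y) ⊕ mul y (mul x y)))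
  cube-⊕ x y k = begin
    cube (x ⊕ y) k
      ≡⟨ mul-⊕ˡ x y (mul (x ⊕ y) (x ⊕ y)) k ⟩
    mul x (mul (x ⊕ y) (x ⊕ y)) k + mul y (mul (x ⊕ y) (x ⊕ y)) k
      ≡⟨ cong₂ _+_ (expand x) (expand y) ⟩
    (xxx + xxy + (mul x (mul y x) k + mul x (mul y y) k)) + (mul y (mul x x) k + yxy + (mul y (mul y x) k + yyy))
      ≡⟨ cong₂ _+_ (cong (_+_ (xxx + xxy)) (cong₂ _+_ (mul-congʳ x (mul-comm y x) k) (sym (mul-rotate x y k))))
                   (cong₂ _+_ (cong (_+ yxy) (trans (sym (mul-rotate y x k)) (mul-congʳ x (mul-comm y x) k)))
                              (cong (_+ yyy) (mul-congʳ y (mul-comm y x) k))) ⟩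
    (xxx + xxy + (xxy + yxy)) + (xxy + yxy + (yxy + yyy))
      ≡⟨ collect xxx xxy yxy yyy ⟩
    xxx + yyy + + 3 * (xxy + yxy) ∎
    where
      xxx = cube x k
      yyy = cube y k
      xxy = mul x (mul x y) k
      yxy = mul y (mul x y) k
      square : mul (x ⊕ y) (x ⊕ y) ≋ (mul x x ⊕ mul x y ⊕ (mul y x ⊕ mul y y))
      square k = trans (mul-⊕ˡ x y (x ⊕ y) k) (cong₂ _+_ (mul-⊕ʳ x x y k) (mul-⊕ʳ y x y k))
      expand : ∀ z → mul z (mul (x ⊕ y) (x ⊕ y)) k ≡
               mul z (mul x x) k + mul z (mul x y) k + (mul z (mul y x) k + mul z (mul y y) k)
      expand z = trans (mul-congʳ z square k)
        (trans (mul-⊕ʳ z (mul x x ⊕ mul x y) (mul y x ⊕ mul y y) k)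
               (cong₂ _+_ (mul-⊕ʳ z (mul x x) (mul x y) k) (mul-⊕ʳ z (mul y x) (mul y y) k)))
      collect : ∀ p q r s → p + q + (q + r) + (q + r + (r + s)) ≡ p + s + + 3 * (q + r)
      collect = solve-∀

  cube-⊙ : ∀ a x → cube (a ⊙ x) ≋ ((a * (a * a)) ⊙ cube x)
  cube-⊙ a x k = begin
    cube (a ⊙ x) k
      ≡⟨ mul-⊙ˡ a x (mul (a ⊙ x) (a ⊙ x)) k ⟩
    a * mul x (mul (a ⊙ x) (a ⊙ x)) k
      ≡⟨ cong (a *_) (mul-congʳ x (λ j → trans (mul-⊙ˡ a x (a ⊙ x) j) (cong (a *_) (mul-⊙ʳ x a x j))) k) ⟩
    a * mul x (a ⊙ (a ⊙ mul x x)) k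
      ≡⟨ cong (a *_) (trans (mul-⊙ʳ x a (a ⊙ mul x x) k) (cong (a *_) (mul-⊙ʳ x a (mul x x) k))) ⟩
    a * (a * (a * cube x k))
      ≡⟨ reassoc a (cube x k) ⟩
    a * (a * a) * cube x k ∎
    where reassoc : ∀ a z → a * (a * (a * z)) ≡ a * (a * a) * z
          reassoc = solve-∀

  CubeIsScalarMod3 : V → Set
  CubeIsScalarMod3 x = Σ ℤ λ n → Σ V λ u → cube x ≋ (n ⊙ one ⊕ + 3 ⊙ u)

  cubeIsScalarMod3-resp : ∀ {x y} → x ≋ y → CubeIsScalarMod3 x → CubeIsScalarMod3 y
  cubeIsScalarMod3-resp x≋y (n , u , e) = n , u , λ k → trans (sym (cube-cong x≋y k)) (e k)

  cubeIsScalarMod3-⊕ : ∀ {x y} → CubeIsScalarMod3 x → CubeIsScalarMod3 y → CubeIsScalarMod3 (x ⊕ y)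
  cubeIsScalarMod3-⊕ {x} {y} (n₁ , u₁ , x³≋) (n₂ , u₂ , y³≋) =
    n₁ + n₂ , u₁ ⊕ u₂ ⊕ (mul x (mul x y) ⊕ mul y (mul x y)) ,
    λ k → trans (cube-⊕ x y k)
            (trans (cong₂ (λ a b → a + b + _) (x³≋ k) (y³≋ k)) (regroup n₁ n₂ (one k) (u₁ k) (u₂ k) _))
    where regroup : ∀ n₁ n₂ o u₁ u₂ w → n₁ * o + + 3 * u₁ + (n₂ * o + + 3 * u₂) + + 3 * w
                                      ≡ (n₁ + n₂) * o + + 3 * (u₁ + u₂ + w)
          regroup = solve-∀

  cubeIsScalarMod3-⊙ : ∀ a {x} → CubeIsScalarMod3 x → CubeIsScalarMod3 (a ⊙ x)
  cubeIsScalarMod3-⊙ a {x} (n , u , e) = a * (a * a) * n , (a * (a * a)) ⊙ u ,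
    λ k → trans (cube-⊙ a x k) (trans (cong (a * (a * a) *_) (e k)) (distrib (a * (a * a)) n (one k) (u k)))
    where distrib : ∀ b n o u → b * (n * o + + 3 * u) ≡ b * n * o + + 3 * (b * u)
          distrib = solve-∀

  cubeIsScalarMod3-3 : ∀ w → CubeIsScalarMod3 (+ 3 ⊙ w)
  cubeIsScalarMod3-3 w = + 0 , + 9 ⊙ cube w , λ k → trans (cube-⊙ (+ 3) w k) (twenty-seven (one k) (cube w k))
    where twenty-seven : ∀ o z → + 27 * z ≡ + 0 * o + + 3 * (+ 9 * z)
          twenty-seven = solve-∀

  cubeIsScalarMod3-one : CubeIsScalarMod3 one
  cubeIsScalarMod3-one = + 1 , (λ _ → + 0) , λ k → trans (unit (mul one one) k) (trans (unit one k) (unit-form (one k)))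
    where unit-form : ∀ o → o ≡ + 1 * o + + 3 * + 0
          unit-form = solve-∀

  cubeIsScalarMod3-mul : ∀ {x y} → CubeIsScalarMod3 x → CubeIsScalarMod3 y → CubeIsScalarMod3 (mul x y)
  cubeIsScalarMod3-mul {x} {y} (n₁ , u , x³≋) (n₂ , v , y³≋) =
    n₁ * n₂ , (λ k → n₁ * v k + n₂ * mul u one k + + 3 * mul u v k) , λ k → begin
      cube (mul x y) k                 ≡⟨ cube-mul x y k ⟩
      mul (cube x) (cube y) k          ≡⟨ mul-cong x³≋ y³≋ k ⟩
      mul X Y k                        ≡⟨ mul-⊕ˡ (n₁ ⊙ one) (+ 3 ⊙ u) Y k ⟩
      mul (n₁ ⊙ one) Y k + mul (+ 3 ⊙ u) Y k
        ≡⟨ cong₂ _+_ (trans (mul-⊙ˡ n₁ one Y k) (cong (n₁ *_) (unit Y k)))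
                     (trans (mul-⊙ˡ (+ 3) u Y k) (cong (+ 3 *_)
                       (trans (mul-⊕ʳ u (n₂ ⊙ one) (+ 3 ⊙ v) k)
                              (cong₂ _+_ (mul-⊙ʳ u n₂ one k) (mul-⊙ʳ u (+ 3) v k))))) ⟩
      n₁ * (n₂ * one k + + 3 * v k) + + 3 * (n₂ * mul u one k + + 3 * mul u v k)
        ≡⟨ expand n₁ n₂ (one k) (v k) (mul u one k) (mul u v k) ⟩
      n₁ * n₂ * one k + + 3 * (n₁ * v k + n₂ * mul u one k + + 3 * mul u v k) ∎
    where
      X = n₁ ⊙ one ⊕ + 3 ⊙ u
      Y = n₂ ⊙ one ⊕ + 3 ⊙ v
      expand : ∀ n₁ n₂ o v uo uv → n₁ * (n₂ * o + + 3 * v) + + 3 * (n₂ * uo + + 3 * uv)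
             ≡ n₁ * n₂ * o + + 3 * (n₁ * v + n₂ * uo + + 3 * uv)
      expand = solve-∀

  -- Only the residue of n modulo 3 matters, so n ranges over {0, 1, 2}.
  cubeIsScalarMod3? : ∀ x → Dec (CubeIsScalarMod3 x)
  cubeIsScalarMod3? x = map′ to from (any? λ r → all? λ k → + 3 ∣? (cube x k - + toℕ r * one k))
    where
      to : (Σ (Fin 3) λ r → ∀ k → + 3 ∣ (cube x k - + toℕ r * one k)) → CubeIsScalarMod3 x
      to (r , 3∣) = + toℕ r , (λ k → _∣_.quotient (3∣ k)) , λ k → unshift (_∣_.equality (3∣ k))
        where
          unshift : ∀ {a b q} → a - b ≡ q * + 3 → a ≡ b + + 3 * q
          unshift {a} {b} {q} eq = trans (split a b) (trans (cong (_+_ b) eq) (flip q b))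
            where split : ∀ a b → a ≡ b + (a - b)
                  split = solve-∀
                  flip : ∀ q b → b + q * + 3 ≡ b + + 3 * q
                  flip = solve-∀
      from : CubeIsScalarMod3 x → Σ (Fin 3) λ r → ∀ k → + 3 ∣ (cube x k - + toℕ r * one k)
      from (n , u , e) = residue n , λ k → divides (n /ℕ 3 * one k + u k)
        (shift (cube x k) n (one k) (u k) (+ toℕ (residue n)) (n /ℕ 3) (e k) (residue-spec n))
        where
          shift : ∀ a n o u r q → a ≡ n * o + + 3 * u → n ≡ r + + 3 * q → a - r * o ≡ (q * o + u) * + 3
          shift _ _ o u r q refl refl = regroup r q o u
            where regroup : ∀ r q o u → (r + + 3 * q) * o + + 3 * u - r * o ≡ (q * o + u) * + 3
                  regroup = solve-∀

  mulMatrix : V → Mat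
  mulMatrix x i = mul x (δ i)

  mulMatrix-represents : ∀ x → Represents δ x (mulMatrix x)
  mulMatrix-represents x i k = sym (lin-δ (mulMatrix x i) k)

  3∣trace-cube : ∀ {x} → CubeIsScalarMod3 x → + 3 ∣ tr (mulMatrix x · mulMatrix x · mulMatrix x)
  3∣trace-cube {x} (n , u , e) = divides (n + Σ3 (λ i → mul u (δ i) i))
    (trans (Σ3-cong diagonal) (collect n (mul u (δ i₀) i₀) (mul u (δ i₁) i₁) (mul u (δ i₂) i₂)))
    where
      X = mulMatrix x
      diagonal : ∀ i → (X · X · X) i i ≡ n + + 3 * mul u (δ i) i
      diagonal i = begin
        (X · X · X) i i                                ≡⟨ sym (lin-δ ((X · X · X) i) i) ⟩
        lin δ ((X · X · X) i) i                        ≡⟨ sym (represents-cube {δ} {x} {X} (mulMatrix-represents x) i i) ⟩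
        mul (cube x) (δ i) i                           ≡⟨ mul-congˡ (δ i) e i ⟩
        mul (n ⊙ one ⊕ + 3 ⊙ u) (δ i) i                ≡⟨ mul-⊕ˡ (n ⊙ one) (+ 3 ⊙ u) (δ i) i ⟩
        mul (n ⊙ one) (δ i) i + mul (+ 3 ⊙ u) (δ i) i  ≡⟨ cong₂ _+_ (trans (mul-⊙ˡ n one (δ i) i)
                                                                         (cong (n *_) (trans (unit (δ i) i) (δ-diag i))))
                                                                  (mul-⊙ˡ (+ 3) u (δ i) i) ⟩
        n * + 1 + + 3 * mul u (δ i) i                   ≡⟨ cong (_+ + 3 * mul u (δ i) i) (*-identityʳ n) ⟩
        n + + 3 * mul u (δ i) i                         ∎
      collect : ∀ n a b c → n + + 3 * a + (n + + 3 * b + (n + + 3 * c)) ≡ (n + (a + (b + c))) * + 3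
      collect = solve-∀

  cubes-scalar⇒zmat : ∀ B → NonZero (det B) → (∀ x → InSpan B x → CubeIsScalarMod3 x) → IsZMatSub C B
  cubes-scalar⇒zmat B det≢0 cubes x x∈B m x-rep =
    subst (+ 3 Unsigned.∣_) (sym (trace-similar B X m {{det≢0}} similar)) (3∣cube⇒3∣ (tr X) (∣⇒∣ᵤ 3∣tr³))
    where
      X = mulMatrix x
      similar : ∀ i → lin X (B i) ≋ lin B (m i)
      similar i k = begin
        lin X (B i) k          ≡⟨ sym (lin-δ (lin X (B i)) k) ⟩
        lin δ (lin X (B i)) k  ≡⟨ sym (represents-lin {δ} {x} {X} (mulMatrix-represents x) (B i) k) ⟩
        mul x (lin δ (B i)) k  ≡⟨ mul-congʳ x (lin-δ (B i)) k ⟩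
        mul x (B i) k          ≡⟨ x-rep i k ⟩
        lin B (m i) k          ∎
      3∣tr³ : + 3 ∣ tr X * (tr X * tr X)
      3∣tr³ = ∣m+n∣n⇒∣m (subst (+ 3 ∣_) (newton₃ X) (3∣trace-cube {x} (cubes x x∈B)))
                        (∣m⇒∣m*n (det X - tr X * e₂ X) ∣-refl)

  zmat⇒cubes-scalar : ∀ B → IsCubicSubring C B → IsZMatSub C B → ∀ x → InSpan B x → CubeIsScalarMod3 x
  zmat⇒cubes-scalar B (_ , (a , one≋) , closed) zmat x x∈B = det m , lin B s , λ k → begin
    cube x k                                  ≡⟨ sym (mul-identityʳ (cube x) k) ⟩
    mul (cube x) one k                        ≡⟨ mul-congʳ (cube x) one≋ k ⟩
    mul (cube x) (lin B a) k                  ≡⟨ represents-lin {B} {cube x} {m · m · m} (represents-cube {B} {x} {m} x-rep) a k ⟩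
    lin B (lin (m · m · m) a) k               ≡⟨ lin-cong B s-spec k ⟩
    lin B (λ j → det m * a j + + 3 * s j) k   ≡⟨ lin-linear (det m) (+ 3) a s B k ⟩
    det m * lin B a k + + 3 * lin B s k       ≡⟨ cong (λ z → det m * z + + 3 * lin B s k) (sym (one≋ k)) ⟩
    det m * one k + + 3 * lin B s k           ∎
    where
      row-in-span : ∀ i → InSpan B (B i)
      row-in-span i = δ i , λ k → sym (lin-at-δ B i k)
      m : Mat
      m i = proj₁ (closed x (B i) x∈B (row-in-span i))
      x-rep : Represents B x m
      x-rep i = proj₂ (closed x (B i) x∈B (row-in-span i))
      3∣tr : + 3 ∣ tr m
      3∣tr = ∣ᵤ⇒∣ (zmat x x∈B m x-rep)
      3∣tr² : + 3 ∣ tr (m · m)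
      3∣tr² = ∣ᵤ⇒∣ (zmat (mul x x) (closed x x x∈B x∈B) (m · m) (represents-mul {B} {x} {x} {m} {m} x-rep x-rep))
      s = proj₁ (cayley-hamilton-mod3 m 3∣tr 3∣tr² a)
      s-spec = proj₂ (cayley-hamilton-mod3 m 3∣tr 3∣tr² a)

proposition3p3 : (C : CubicRing) →
    Σ (Fin 3 → V) λ B → IsCubicSubring C B × IsZMatSub C B ×
    (∀ B′ → IsCubicSubring C B′ → IsZMatSub C B′ → ∀ x → InSpan B′ x → InSpan B x)
proposition3p3 C =
  basis , (det≢0⇒independent basis {{basis-det≢0}} , basis-spans one cubeIsScalarMod3-one , closed) ,
  cubes-scalar⇒zmat basis basis-det≢0 span-member ,
  λ B′ subring zmat x x∈B′ → basis-spans x (zmat⇒cubes-scalar B′ subring zmat x x∈B′)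
  where
    open CubicRing C
    open CubicRingProperties C
    open TriangularBasis CubeIsScalarMod3 (λ {x} {y} → cubeIsScalarMod3-resp {x} {y})
      (λ {x} {y} → cubeIsScalarMod3-⊕ {x} {y}) (λ n {x} → cubeIsScalarMod3-⊙ n {x})
      cubeIsScalarMod3-3 cubeIsScalarMod3?
    closed : ∀ x y → InSpan basis x → InSpan basis y → InSpan basis (mul x y)
    closed x y x∈B y∈B =
      basis-spans (mul x y) (cubeIsScalarMod3-mul {x} {y} (span-member x x∈B) (span-member y y∈B))
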